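{- Let $p$ be an odd prime, $\omega=e^{2\pi i/p}$, $K=\mathbb{Q}(\omega)$, $N$ a positive integer and $B(p,N)=\{a_1\omega+\cdots+a_{p-1}\omega^{p-1}: a_i\in\mathbb{Z}\cap[-N,N]\}$. Then $$M_4(p,N):=\frac{1}{\#B(p,N)^2}\sum_{\alpha\in B(p,N)}\sum_{\beta\in B(p,N)}d(\alpha,\beta)^4$$ equals $$\frac{2}{45}N(N+1)(p-1)\Big((2N^2+2N)\left(5p^5-8p^4+p^3+8p^2-21p-18\right)-3(p^2-p-1)^2\Big)=\frac{4}{9}p^6N^4+O(p^5N^4+p^6N^3),$$ where the implied constant is absolute.
   Context: $\operatorname{Tr}_{K/\mathbb{Q}}(\alpha)=\sum_{\sigma\in\operatorname{Gal}(K/\mathbb{Q})}\sigma(\alpha)$. For $\alpha\in K$, $\|\alpha\|=\sqrt{\sum_{j=1}^{p-1}\operatorname{Tr}_{K/\mathbb{Q}}(\alpha\omega^j)^2}$, and $d(\alpha,\beta)=\|\alpha-\beta\|$. $f=O(g)$ means $|f|\le C|g|$ for an absolute constant $C$. -}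

module Defs where

open import Data.Nat as ℕ using (ℕ; _∸_)
open import Data.Nat.Divisibility using (_∣?_)
open import Data.Integer as ℤ using (ℤ; +_)
open import Data.Rational as ℚ using (ℚ)
open import Data.List using (List; []; _∷_; map; upTo; concatMap; foldr)
open import Data.Vec using (Vec; []; _∷_; lookup; zipWith)
open import Data.Fin using (Fin; toℕ; zero; suc)
open import Relation.Nullary using (does)
open import Data.Bool using (if_then_else_)

-- Tr_{K/Q}(ω^k) for K = Q(ω), ω = e^{2πi/p}, p prime:
-- Σ_{σ ∈ Gal} σ(ω^k) = Σ_{m=1}^{p-1} ω^{km} = p-1 if p ∣ k, and -1 otherwise.
trω : ℕ → ℕ → ℤ
trω p k = if does (p ∣? k) then + (p ∸ 1) else ℤ.- (+ 1)

-- An element a₁ω + ⋯ + a_{p-1}ω^{p-1} of K with integer coordinates is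
-- represented by its coordinate vector (a₁,…,a_{p-1}); index i : Fin (p-1)
-- stands for the coefficient of ω^{i+1}.
Elt : ℕ → Set
Elt p = Vec ℤ (p ∸ 1)

Σ[_] : (n : ℕ) → (Fin n → ℤ) → ℤ
Σ[ ℕ.zero ] f = + 0
Σ[ ℕ.suc n ] f = f zero ℤ.+ Σ[ n ] (λ i → f (suc i))

-- Tr_{K/Q}(α ω^j) = Σ_i a_i Tr(ω^{i+j}) by Q-linearity of the trace
trMul : (p : ℕ) → Elt p → ℕ → ℤ
trMul p a j = Σ[ p ∸ 1 ] (λ i → lookup a i ℤ.* trω p (ℕ.suc (toℕ i) ℕ.+ j))

normSq : (p : ℕ) → Elt p → ℤ
normSq p a = Σ[ p ∸ 1 ] (λ j → let t = trMul p a (ℕ.suc (toℕ j)) in t ℤ.* t)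

dist4 : (p : ℕ) → Elt p → Elt p → ℤ
dist4 p a b = let s = normSq p (zipWith ℤ._-_ a b) in s ℤ.* s

range : ℕ → List ℤ
range N = map (λ k → + k ℤ.- + N) (upTo (ℕ.suc (2 ℕ.* N)))

vecs : (n : ℕ) → List ℤ → List (Vec ℤ n)
vecs ℕ.zero xs = [] ∷ []
vecs (ℕ.suc n) xs = concatMap (λ x → map (x ∷_) (vecs n xs)) xs

-- B(p,N), listed by coordinate vectors (distinct vectors give distinct
-- elements since ω,…,ω^{p-1} is a Q-basis of K)
B : (p : ℕ) → ℕ → List (Elt p)
B p N = vecs (p ∸ 1) (range N)

open import Data.List using (length)

-- average: S / d  (d = 0 never occurs; returns 0 there)
avg : ℤ → ℕ → ℚ
avg S ℕ.zero = ℚ.0ℚ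
avg S (ℕ.suc d) = S ℚ./ ℕ.suc d

sumD4 : ℕ → ℕ → ℤ
sumD4 p N = foldr ℤ._+_ (+ 0) (concatMap (λ a → map (dist4 p a) (B p N)) (B p N))

cardB : ℕ → ℕ → ℕ
cardB p N = length (B p N)

M4 : ℕ → ℕ → ℚ
M4 p N = avg (sumD4 p N) (cardB p N ℕ.* cardB p N)

closedForm : ℕ → ℕ → ℚ
closedForm p N =
  (+ 2 ℤ.* n ℤ.* (n ℤ.+ + 1) ℤ.* (q ℤ.- + 1)
     ℤ.* ((+ 2 ℤ.* n ℤ.^ 2 ℤ.+ + 2 ℤ.* n)
            ℤ.* (+ 5 ℤ.* q ℤ.^ 5 ℤ.- + 8 ℤ.* q ℤ.^ 4 ℤ.+ q ℤ.^ 3 ℤ.+ + 8 ℤ.* q ℤ.^ 2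
                 ℤ.- + 21 ℤ.* q ℤ.- + 18)
          ℤ.- + 3 ℤ.* (q ℤ.^ 2 ℤ.- q ℤ.- + 1) ℤ.^ 2)) ℚ./ 45
  where
  n = + N
  q = + p

-- The trace of ω^k is p − 1 if p ∣ k and −1 otherwise, and for coordinates i, j the exponent
-- (i + 1) + (j + 1) is a multiple of p only when i + j = p − 2. Hence Tr(α ω^j) = p a_{p−j} − Σ a
-- and ‖α‖² = G(a) := p² Σ aᵢ² − (p + 1) (Σ aᵢ)², a quadratic form in the coordinates.
-- The double sum of G(a − b)² over B(p,N)² is the sum of G(d)² over d ∈ Δ^(p−1), where Δ is the
-- multiset of differences x − y of elements of [−N, N]. As Δ is symmetric, peeling off one
-- coordinate at a time expresses Σ G(d) and Σ G(d)² through |Δ|, Σ z² and Σ z⁴ alone, and these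
-- come from the power sums Σ x² and Σ x⁴ over [−N, N], which telescope.
-- For the estimate, every monomial of 45 closedForm − 20 p⁶ N⁴ is at most p⁵ N⁴ or p⁶ N³ when
-- p, N ≥ 1, and the absolute values of its coefficients add up to 1432 ≤ 45 · 32.
module Submission where

open import Defs

module ExactValue where

  open import Data.Bool using (if_then_else_)
  open import Data.Empty using (⊥-elim)
  open import Data.Fin as Fin using (Fin; toℕ; opposite; punchIn)
  open import Data.Fin.Permutation using (reverse)
  open import Data.Fin.Properties as Fin using (punchInᵢ≢i)
  open import Data.Integer as ℤ using (ℤ; +_; _+_; _*_; _-_; -_; _^_)
  open import Data.Integer.Properties as ℤ using ()
  open import Data.Integer.Tactic.RingSolver using (solve-∀)
  open import Data.List using (List; []; _∷_; _++_; _∷ʳ_; map; concatMap; foldr; length; upTo)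
  open import Data.List.Properties using (upTo-∷ʳ; length-map; length-upTo)
  open import Data.Nat as ℕ using (ℕ; zero; suc; _∸_; s≤s; z≤n)
  open import Data.Nat.Divisibility using (_∣_; _∣?_; divides; ∣-refl)
  open import Data.Nat.Properties as ℕ using ()
  open import Data.Rational as ℚ using ()
  open import Data.Rational.Properties as ℚ using ()
  open import Data.Rational.Unnormalised using (mkℚᵘ; *≡*)
  open import Data.Vec using (Vec; []; _∷_; lookup; zipWith)
  open import Function using (_∘_)
  open import Relation.Binary.PropositionalEquality
  open import Relation.Nullary using (¬_)
  open import Relation.Nullary.Decidable using (dec-true; dec-false)
  open import Algebra.Properties.Semiring.Sum ℤ.+-*-semiring using (sum; sum-remove; ∑-permute; sum-cong-≗; *-distribʳ-sum)

  private variable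
    A A′ : Set
    n : ℕ

  ∑ : List A → (A → ℤ) → ℤ
  ∑ []       f = + 0
  ∑ (x ∷ xs) f = f x + ∑ xs f

  infix 5 ∑
  syntax ∑ xs (λ x → e) = ∑[ x ∈ xs ] e

  ∑-cong : ∀ (xs : List A) {f g : A → ℤ} → (∀ x → f x ≡ g x) → ∑ xs f ≡ ∑ xs g
  ∑-cong []       f≗g = refl
  ∑-cong (x ∷ xs) f≗g = cong₂ _+_ (f≗g x) (∑-cong xs f≗g)

  ∑-distrib-+ : ∀ (xs : List A) (f g : A → ℤ) →
                ∑[ x ∈ xs ] (f x + g x) ≡ ∑ xs f + ∑ xs g
  ∑-distrib-+ []       f g = refl
  ∑-distrib-+ (x ∷ xs) f g = trans (cong (_+_ (f x + g x)) (∑-distrib-+ xs f g))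
                                   (swap (f x) (g x) (∑ xs f) (∑ xs g))
    where
    swap : ∀ a b c d → (a + b) + (c + d) ≡ (a + c) + (b + d)
    swap = solve-∀

  *-distribˡ-∑ : ∀ c (xs : List A) (f : A → ℤ) → c * ∑ xs f ≡ ∑[ x ∈ xs ] (c * f x)
  *-distribˡ-∑ c []       f = ℤ.*-zeroʳ c
  *-distribˡ-∑ c (x ∷ xs) f = trans (ℤ.*-distribˡ-+ c (f x) (∑ xs f))
                                    (cong (_+_ (c * f x)) (*-distribˡ-∑ c xs f))

  ∑-const : ∀ (xs : List A) c → ∑[ x ∈ xs ] c ≡ + length xs * c
  ∑-const []       c = refl
  ∑-const (x ∷ xs) c = trans (cong (_+_ c) (∑-const xs c)) (sym (ℤ.suc-* (+ length xs) c))

  ∑-zero : ∀ (xs : List A) → ∑[ x ∈ xs ] + 0 ≡ + 0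
  ∑-zero xs = trans (∑-const xs (+ 0)) (ℤ.*-zeroʳ (+ length xs))

  ∑-++ : ∀ (xs ys : List A) (f : A → ℤ) → ∑ (xs ++ ys) f ≡ ∑ xs f + ∑ ys f
  ∑-++ []       ys f = sym (ℤ.+-identityˡ (∑ ys f))
  ∑-++ (x ∷ xs) ys f = trans (cong (_+_ (f x)) (∑-++ xs ys f)) (sym (ℤ.+-assoc (f x) _ _))

  ∑-comm : (xs : List A) (ys : List A′) (f : A → A′ → ℤ) →
           ∑[ x ∈ xs ] ∑[ y ∈ ys ] f x y ≡ ∑[ y ∈ ys ] ∑[ x ∈ xs ] f x y
  ∑-comm []       ys f = sym (∑-zero ys)
  ∑-comm (x ∷ xs) ys f = trans (cong (_+_ (∑ ys (f x))) (∑-comm xs ys f))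
                               (sym (∑-distrib-+ ys (f x) (λ y → ∑[ x ∈ xs ] f x y)))

  ∑-map : (g : A → A′) (xs : List A) (f : A′ → ℤ) → ∑ (map g xs) f ≡ ∑[ x ∈ xs ] f (g x)
  ∑-map g []       f = refl
  ∑-map g (x ∷ xs) f = cong (_+_ (f (g x))) (∑-map g xs f)

  ∑-concatMap : (g : A → List A′) (xs : List A) (f : A′ → ℤ) →
                ∑ (concatMap g xs) f ≡ ∑[ x ∈ xs ] ∑ (g x) f
  ∑-concatMap g []       f = refl
  ∑-concatMap g (x ∷ xs) f = trans (∑-++ (g x) (concatMap g xs) f) (cong (_+_ (∑ (g x) f)) (∑-concatMap g xs f))

  foldr-+≡∑ : ∀ (xs : List ℤ) → foldr _+_ (+ 0) xs ≡ ∑[ x ∈ xs ] x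
  foldr-+≡∑ []       = refl
  foldr-+≡∑ (x ∷ xs) = cong (_+_ x) (foldr-+≡∑ xs)

  Σ≡sum : ∀ n (f : Fin n → ℤ) → Σ[ n ] f ≡ sum f
  Σ≡sum zero    f = refl
  Σ≡sum (suc n) f = cong (_+_ (f Fin.zero)) (Σ≡sum n (f ∘ Fin.suc))

  entrySum squareSum : Vec ℤ n → ℤ
  entrySum c  = sum (lookup c)
  squareSum c = sum (λ i → lookup c i * lookup c i)

  sum-quadratic : ∀ a b k (c : Vec ℤ n) →
    sum (λ i → a * (lookup c i * lookup c i) + b * lookup c i + k) ≡
    a * squareSum c + b * entrySum c + + n * k
  sum-quadratic a b k []      = sym (ring a b k)
    where
    ring : ∀ a b k → a * + 0 + b * + 0 + + 0 * k ≡ + 0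
    ring = solve-∀
  sum-quadratic {suc n} a b k (x ∷ c) =
    trans (cong (_+_ (a * (x * x) + b * x + k)) (sum-quadratic a b k c))
          (ring a b k x (squareSum c) (entrySum c) (+ n))
    where
    ring : ∀ a b k x q s m → a * (x * x) + b * x + k + (a * q + b * s + m * k) ≡
                             a * (x * x + q) + b * (x + s) + (+ 1 + m) * k
    ring = solve-∀

  m∣n∧0<n<m+m⇒n≡m : ∀ {m n} → m ∣ n → 0 ℕ.< n → n ℕ.< m ℕ.+ m → n ≡ m
  m∣n∧0<n<m+m⇒n≡m {m} (divides zero          refl) ()
  m∣n∧0<n<m+m⇒n≡m {m} (divides (suc zero)    refl) _ _     = ℕ.+-identityʳ m
  m∣n∧0<n<m+m⇒n≡m {m} (divides (suc (suc q)) refl) _ n<2m =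
    ⊥-elim (ℕ.<⇒≱ n<2m (ℕ.+-monoʳ-≤ m (ℕ.m≤m+n m (q ℕ.* m))))

  exponent-opposite : ∀ (j : Fin n) → suc (toℕ (opposite j)) ℕ.+ suc (toℕ j) ≡ suc n
  exponent-opposite {n} j = begin
    suc (toℕ (opposite j)) ℕ.+ suc (toℕ j) ≡⟨ cong (λ k → suc k ℕ.+ suc (toℕ j)) (Fin.opposite-prop j) ⟩
    suc (n ∸ suc (toℕ j) ℕ.+ suc (toℕ j))  ≡⟨ cong suc (ℕ.m∸n+n≡m (Fin.toℕ<n j)) ⟩
    suc n                                   ∎
    where open ≡-Reasoning

  exponent≡⇒opposite : ∀ (i j : Fin n) → suc (toℕ i) ℕ.+ suc (toℕ j) ≡ suc n → i ≡ opposite j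
  exponent≡⇒opposite {n} i j eq = Fin.toℕ-injective (begin
    toℕ i                                ≡⟨ ℕ.m+n∸n≡m (toℕ i) (suc (toℕ j)) ⟨
    toℕ i ℕ.+ suc (toℕ j) ∸ suc (toℕ j)  ≡⟨ cong (_∸ suc (toℕ j)) (ℕ.suc-injective eq) ⟩
    n ∸ suc (toℕ j)                      ≡⟨ Fin.opposite-prop j ⟨
    toℕ (opposite j)                     ∎)
    where open ≡-Reasoning

  trω-opposite : ∀ (j : Fin n) → trω (suc n) (suc (toℕ (opposite j)) ℕ.+ suc (toℕ j)) ≡ + n
  trω-opposite {n} j rewrite exponent-opposite j =
    cong (λ b → if b then + n else - + 1) (dec-true (suc n ∣? suc n) ∣-refl)

  trω-not-opposite : ∀ (i j : Fin n) → i ≢ opposite j →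
                     trω (suc n) (suc (toℕ i) ℕ.+ suc (toℕ j)) ≡ - + 1
  trω-not-opposite {n} i j i≢ = cong (λ b → if b then + n else - + 1) (dec-false (suc n ∣? _) p∤)
    where
    p∤ : ¬ suc n ∣ suc (toℕ i) ℕ.+ suc (toℕ j)
    p∤ p∣ = i≢ (exponent≡⇒opposite i j
               (m∣n∧0<n<m+m⇒n≡m p∣ (s≤s z≤n) (ℕ.+-mono-< (s≤s (Fin.toℕ<n i)) (s≤s (Fin.toℕ<n j)))))

  trMul-formula : ∀ (c : Vec ℤ (suc n)) (j : Fin (suc n)) →
    trMul (suc (suc n)) c (suc (toℕ j)) ≡ + suc (suc n) * lookup c (opposite j) - entrySum c
  trMul-formula {n} c j = begin
    trMul (suc (suc n)) c (suc (toℕ j))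
      ≡⟨ Σ≡sum (suc n) (λ i → cᵢ i * τ i) ⟩
    sum (λ i → cᵢ i * τ i)
      ≡⟨ sum-remove {i = j′} (λ i → cᵢ i * τ i) ⟩
    cᵢ j′ * τ j′ + sum (λ k → cᵢ (punchIn j′ k) * τ (punchIn j′ k))
      ≡⟨ cong₂ (λ a b → cᵢ j′ * a + b) (trω-opposite j) (sum-cong-≗ λ k →
           cong (cᵢ (punchIn j′ k) *_) (trω-not-opposite (punchIn j′ k) j (punchInᵢ≢i j′ k))) ⟩
    cᵢ j′ * + suc n + sum (λ k → cᵢ (punchIn j′ k) * - + 1)
      ≡⟨ cong (_+_ (cᵢ j′ * + suc n)) (*-distribʳ-sum (- + 1) (cᵢ ∘ punchIn j′)) ⟨
    cᵢ j′ * + suc n + sum (cᵢ ∘ punchIn j′) * - + 1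
      ≡⟨ ring (+ n) (cᵢ j′) (sum (cᵢ ∘ punchIn j′)) ⟩
    + suc (suc n) * cᵢ j′ - (cᵢ j′ + sum (cᵢ ∘ punchIn j′))
      ≡⟨ cong (_-_ (+ suc (suc n) * cᵢ j′)) (sum-remove {i = j′} cᵢ) ⟨
    + suc (suc n) * cᵢ j′ - entrySum c ∎
    where
    open ≡-Reasoning
    cᵢ = lookup c
    j′ = opposite j
    τ : Fin (suc n) → ℤ
    τ i = trω (suc (suc n)) (suc (toℕ i) ℕ.+ suc (toℕ j))
    ring : ∀ n x r → x * (+ 1 + n) + r * - + 1 ≡ (+ 1 + (+ 1 + n)) * x - (x + r)
    ring = solve-∀

  quadForm : ℤ → ℤ → Vec ℤ n → ℤ
  quadForm t u c = t * squareSum c + u * (entrySum c * entrySum c)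

  normSq≡quadForm : ∀ (c : Vec ℤ n) →
    normSq (suc n) c ≡ quadForm (+ suc n * + suc n) (- (+ suc n + + 1)) c
  normSq≡quadForm []                = refl
  normSq≡quadForm {suc n} c@(_ ∷ _) = begin
    normSq p c
      ≡⟨ Σ≡sum (suc n) (λ j → t j * t j) ⟩
    sum (λ j → t j * t j)
      ≡⟨ sum-cong-≗ (λ j → cong (λ x → x * x) (trMul-formula c j)) ⟩
    sum (λ j → (P * cᵢ (opposite j) - S) * (P * cᵢ (opposite j) - S))
      ≡⟨ ∑-permute (λ j → (P * cᵢ j - S) * (P * cᵢ j - S)) reverse ⟨
    sum (λ j → (P * cᵢ j - S) * (P * cᵢ j - S))
      ≡⟨ sum-cong-≗ (λ j → expand P S (cᵢ j)) ⟩
    sum (λ j → P * P * (cᵢ j * cᵢ j) + - (+ 2 * P * S) * cᵢ j + S * S)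
      ≡⟨ sum-quadratic (P * P) (- (+ 2 * P * S)) (S * S) c ⟩
    P * P * squareSum c + - (+ 2 * P * S) * S + + suc n * (S * S)
      ≡⟨ collect (+ n) (squareSum c) S ⟩
    quadForm (P * P) (- (P + + 1)) c ∎
    where
    open ≡-Reasoning
    p = suc (suc n)
    P = + p
    S = entrySum c
    cᵢ = lookup c
    t : Fin (suc n) → ℤ
    t j = trMul p c (suc (toℕ j))
    expand : ∀ P S x → (P * x - S) * (P * x - S) ≡ P * P * (x * x) + - (+ 2 * P * S) * x + S * S
    expand = solve-∀
    collect : ∀ n q s → let P = + 1 + (+ 1 + n) in
      P * P * q + - (+ 2 * P * s) * s + (+ 1 + n) * (s * s) ≡ P * P * q + - (P + + 1) * (s * s)
    collect = solve-∀

  ∑-vecs-suc : ∀ (xs : List ℤ) (F : Vec ℤ (suc n) → ℤ) →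
               ∑ (vecs (suc n) xs) F ≡ ∑[ x ∈ xs ] ∑[ v ∈ vecs n xs ] F (x ∷ v)
  ∑-vecs-suc {n} xs F = trans (∑-concatMap (λ x → map (x ∷_) (vecs n xs)) xs F)
                              (∑-cong xs (λ x → ∑-map (x ∷_) (vecs n xs) F))

  differences : List ℤ → List ℤ
  differences xs = concatMap (λ x → map (λ y → x - y) xs) xs

  ∑-differences : ∀ xs (f : ℤ → ℤ) → ∑ (differences xs) f ≡ ∑[ x ∈ xs ] ∑[ y ∈ xs ] f (x - y)
  ∑-differences xs f = trans (∑-concatMap (λ x → map (λ y → x - y) xs) xs f)
                             (∑-cong xs (λ x → ∑-map (λ y → x - y) xs f))

  ∑²-vecs-differences : ∀ n xs (F : Vec ℤ n → ℤ) →
    ∑[ a ∈ vecs n xs ] ∑[ b ∈ vecs n xs ] F (zipWith _-_ a b) ≡ ∑ (vecs n (differences xs)) F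
  ∑²-vecs-differences zero    xs F = ℤ.+-identityʳ _
  ∑²-vecs-differences (suc n) xs F = begin
    ∑[ a ∈ vecs (suc n) xs ] ∑[ b ∈ vecs (suc n) xs ] F (zipWith _-_ a b)
      ≡⟨ ∑-vecs-suc xs _ ⟩
    ∑[ x ∈ xs ] ∑[ a ∈ vecs n xs ] ∑[ b ∈ vecs (suc n) xs ] F (zipWith _-_ (x ∷ a) b)
      ≡⟨ ∑-cong xs (λ x → ∑-cong (vecs n xs) (λ a → ∑-vecs-suc xs _)) ⟩
    ∑[ x ∈ xs ] ∑[ a ∈ vecs n xs ] ∑[ y ∈ xs ] ∑[ b ∈ vecs n xs ] F ((x - y) ∷ zipWith _-_ a b)
      ≡⟨ ∑-cong xs (λ x → ∑-comm (vecs n xs) xs _) ⟩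
    ∑[ x ∈ xs ] ∑[ y ∈ xs ] ∑[ a ∈ vecs n xs ] ∑[ b ∈ vecs n xs ] F ((x - y) ∷ zipWith _-_ a b)
      ≡⟨ ∑-cong xs (λ x → ∑-cong xs (λ y → ∑²-vecs-differences n xs (λ d → F ((x - y) ∷ d)))) ⟩
    ∑[ x ∈ xs ] ∑[ y ∈ xs ] ∑[ d ∈ vecs n (differences xs) ] F ((x - y) ∷ d)
      ≡⟨ ∑-differences xs _ ⟨
    ∑[ z ∈ differences xs ] ∑[ d ∈ vecs n (differences xs) ] F (z ∷ d)
      ≡⟨ ∑-vecs-suc (differences xs) F ⟨
    ∑ (vecs (suc n) (differences xs)) F ∎
    where open ≡-Reasoning

  quartic : ℤ → ℤ → ℤ → ℤ → ℤ → ℤ → ℤ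
  quartic a₀ a₁ a₂ a₃ a₄ z = a₀ + a₁ * z + a₂ * (z * z) + a₃ * (z * z * z) + a₄ * (z * z * z * z)

  ∑-quartic : ∀ xs a₀ a₁ a₂ a₃ a₄ →
    ∑[ x ∈ xs ] quartic a₀ a₁ a₂ a₃ a₄ x ≡
    a₀ * ∑ xs (λ _ → + 1) + a₁ * ∑ xs (λ x → x) + a₂ * ∑ xs (λ x → x * x) +
    a₃ * ∑ xs (λ x → x * x * x) + a₄ * ∑ xs (λ x → x * x * x * x)
  ∑-quartic []       a₀ a₁ a₂ a₃ a₄ = sym (ring a₀ a₁ a₂ a₃ a₄)
    where
    ring : ∀ a₀ a₁ a₂ a₃ a₄ → a₀ * + 0 + a₁ * + 0 + a₂ * + 0 + a₃ * + 0 + a₄ * + 0 ≡ + 0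
    ring = solve-∀
  ∑-quartic (x ∷ xs) a₀ a₁ a₂ a₃ a₄ =
    trans (cong (_+_ (quartic a₀ a₁ a₂ a₃ a₄ x)) (∑-quartic xs a₀ a₁ a₂ a₃ a₄)) (ring a₀ a₁ a₂ a₃ a₄ x _ _ _ _ _)
    where
    ring : ∀ a₀ a₁ a₂ a₃ a₄ x p₀ p₁ p₂ p₃ p₄ →
      a₀ + a₁ * x + a₂ * (x * x) + a₃ * (x * x * x) + a₄ * (x * x * x * x) +
        (a₀ * p₀ + a₁ * p₁ + a₂ * p₂ + a₃ * p₃ + a₄ * p₄) ≡
      a₀ * (+ 1 + p₀) + a₁ * (x + p₁) + a₂ * (x * x + p₂) + a₃ * (x * x * x + p₃) + a₄ * (x * x * x * x + p₄)
    ring = solve-∀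

  ∑-quartic-coefficients : ∀ (ds : List A) (c₀ c₁ c₂ c₃ c₄ : A → ℤ) z →
    ∑[ d ∈ ds ] quartic (c₀ d) (c₁ d) (c₂ d) (c₃ d) (c₄ d) z ≡
    quartic (∑ ds c₀) (∑ ds c₁) (∑ ds c₂) (∑ ds c₃) (∑ ds c₄) z
  ∑-quartic-coefficients []       c₀ c₁ c₂ c₃ c₄ z = sym (ring z)
    where
    ring : ∀ z → + 0 + + 0 * z + + 0 * (z * z) + + 0 * (z * z * z) + + 0 * (z * z * z * z) ≡ + 0
    ring = solve-∀
  ∑-quartic-coefficients (d ∷ ds) c₀ c₁ c₂ c₃ c₄ z =
    trans (cong (_+_ (quartic (c₀ d) (c₁ d) (c₂ d) (c₃ d) (c₄ d) z)) (∑-quartic-coefficients ds c₀ c₁ c₂ c₃ c₄ z))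
          (ring (c₀ d) (c₁ d) (c₂ d) (c₃ d) (c₄ d) (∑ ds c₀) (∑ ds c₁) (∑ ds c₂) (∑ ds c₃) (∑ ds c₄) z)
    where
    ring : ∀ a₀ a₁ a₂ a₃ a₄ b₀ b₁ b₂ b₃ b₄ z →
      a₀ + a₁ * z + a₂ * (z * z) + a₃ * (z * z * z) + a₄ * (z * z * z * z) +
        (b₀ + b₁ * z + b₂ * (z * z) + b₃ * (z * z * z) + b₄ * (z * z * z * z)) ≡
      (a₀ + b₀) + (a₁ + b₁) * z + (a₂ + b₂) * (z * z) + (a₃ + b₃) * (z * z * z) + (a₄ + b₄) * (z * z * z * z)
    ring = solve-∀

  ∑-quartic-shift : ∀ ys a₀ a₁ a₂ a₃ a₄ x →
    let s₀ = ∑ ys (λ _ → + 1); s₁ = ∑ ys (λ y → y); s₂ = ∑ ys (λ y → y * y)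
        s₃ = ∑ ys (λ y → y * y * y); s₄ = ∑ ys (λ y → y * y * y * y) in
    ∑[ y ∈ ys ] quartic a₀ a₁ a₂ a₃ a₄ (x - y) ≡
    quartic (a₀ * s₀ - a₁ * s₁ + a₂ * s₂ - a₃ * s₃ + a₄ * s₄)
            (a₁ * s₀ - + 2 * a₂ * s₁ + + 3 * a₃ * s₂ - + 4 * a₄ * s₃)
            (a₂ * s₀ - + 3 * a₃ * s₁ + + 6 * a₄ * s₂)
            (a₃ * s₀ - + 4 * a₄ * s₁)
            (a₄ * s₀) x
  ∑-quartic-shift []       a₀ a₁ a₂ a₃ a₄ x = sym (ring a₀ a₁ a₂ a₃ a₄ x)
    where
    ring : ∀ a₀ a₁ a₂ a₃ a₄ x →
      (a₀ * + 0 - a₁ * + 0 + a₂ * + 0 - a₃ * + 0 + a₄ * + 0) +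
      (a₁ * + 0 - + 2 * a₂ * + 0 + + 3 * a₃ * + 0 - + 4 * a₄ * + 0) * x +
      (a₂ * + 0 - + 3 * a₃ * + 0 + + 6 * a₄ * + 0) * (x * x) +
      (a₃ * + 0 - + 4 * a₄ * + 0) * (x * x * x) + a₄ * + 0 * (x * x * x * x) ≡ + 0
    ring = solve-∀
  ∑-quartic-shift (y ∷ ys) a₀ a₁ a₂ a₃ a₄ x =
    trans (cong (_+_ (quartic a₀ a₁ a₂ a₃ a₄ (x - y))) (∑-quartic-shift ys a₀ a₁ a₂ a₃ a₄ x))
          (ring a₀ a₁ a₂ a₃ a₄ x y (∑ ys (λ _ → + 1)) (∑ ys (λ y → y)) (∑ ys (λ y → y * y))
                (∑ ys (λ y → y * y * y)) (∑ ys (λ y → y * y * y * y)))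
    where
    ring : ∀ a₀ a₁ a₂ a₃ a₄ x y s₀ s₁ s₂ s₃ s₄ →
      let t₀ = + 1 + s₀; t₁ = y + s₁; t₂ = y * y + s₂; t₃ = y * y * y + s₃; t₄ = y * y * y * y + s₄ in
      a₀ + a₁ * (x - y) + a₂ * ((x - y) * (x - y)) + a₃ * ((x - y) * (x - y) * (x - y)) +
        a₄ * ((x - y) * (x - y) * (x - y) * (x - y)) +
      ((a₀ * s₀ - a₁ * s₁ + a₂ * s₂ - a₃ * s₃ + a₄ * s₄) +
       (a₁ * s₀ - + 2 * a₂ * s₁ + + 3 * a₃ * s₂ - + 4 * a₄ * s₃) * x +
       (a₂ * s₀ - + 3 * a₃ * s₁ + + 6 * a₄ * s₂) * (x * x) +
       (a₃ * s₀ - + 4 * a₄ * s₁) * (x * x * x) + a₄ * s₀ * (x * x * x * x)) ≡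
      (a₀ * t₀ - a₁ * t₁ + a₂ * t₂ - a₃ * t₃ + a₄ * t₄) +
      (a₁ * t₀ - + 2 * a₂ * t₁ + + 3 * a₃ * t₂ - + 4 * a₄ * t₃) * x +
      (a₂ * t₀ - + 3 * a₃ * t₁ + + 6 * a₄ * t₂) * (x * x) +
      (a₃ * t₀ - + 4 * a₄ * t₁) * (x * x * x) + a₄ * t₀ * (x * x * x * x)
    ring = solve-∀

  -- The power sums ∑ z ^ k of zs for k = 0, …, 4 are m₀, 0, m₂, 0, m₄.
  EvenMoments : List ℤ → ℤ → ℤ → ℤ → Set
  EvenMoments zs m₀ m₂ m₄ =
    ∀ a₀ a₁ a₂ a₃ a₄ → ∑[ z ∈ zs ] quartic a₀ a₁ a₂ a₃ a₄ z ≡ a₀ * m₀ + a₂ * m₂ + a₄ * m₄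

  differences-evenMoments : ∀ xs →
    let s₀ = ∑ xs (λ _ → + 1); s₁ = ∑ xs (λ x → x); s₂ = ∑ xs (λ x → x * x)
        s₃ = ∑ xs (λ x → x * x * x); s₄ = ∑ xs (λ x → x * x * x * x) in
    EvenMoments (differences xs) (s₀ * s₀) (+ 2 * (s₀ * s₂ - s₁ * s₁))
                (+ 2 * (s₀ * s₄) - + 8 * (s₁ * s₃) + + 6 * (s₂ * s₂))
  differences-evenMoments xs a₀ a₁ a₂ a₃ a₄ = begin
    ∑[ z ∈ differences xs ] quartic a₀ a₁ a₂ a₃ a₄ z
      ≡⟨ ∑-differences xs _ ⟩
    ∑[ x ∈ xs ] ∑[ y ∈ xs ] quartic a₀ a₁ a₂ a₃ a₄ (x - y)
      ≡⟨ ∑-cong xs (∑-quartic-shift xs a₀ a₁ a₂ a₃ a₄) ⟩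
    ∑[ x ∈ xs ] quartic c₀ c₁ c₂ c₃ c₄ x
      ≡⟨ ∑-quartic xs c₀ c₁ c₂ c₃ c₄ ⟩
    c₀ * s₀ + c₁ * s₁ + c₂ * s₂ + c₃ * s₃ + c₄ * s₄
      ≡⟨ ring a₀ a₁ a₂ a₃ a₄ s₀ s₁ s₂ s₃ s₄ ⟩
    a₀ * (s₀ * s₀) + a₂ * (+ 2 * (s₀ * s₂ - s₁ * s₁)) + a₄ * (+ 2 * (s₀ * s₄) - + 8 * (s₁ * s₃) + + 6 * (s₂ * s₂)) ∎
    where
    open ≡-Reasoning
    s₀ = ∑ xs (λ _ → + 1)
    s₁ = ∑ xs (λ x → x)
    s₂ = ∑ xs (λ x → x * x)
    s₃ = ∑ xs (λ x → x * x * x)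
    s₄ = ∑ xs (λ x → x * x * x * x)
    c₀ = a₀ * s₀ - a₁ * s₁ + a₂ * s₂ - a₃ * s₃ + a₄ * s₄
    c₁ = a₁ * s₀ - + 2 * a₂ * s₁ + + 3 * a₃ * s₂ - + 4 * a₄ * s₃
    c₂ = a₂ * s₀ - + 3 * a₃ * s₁ + + 6 * a₄ * s₂
    c₃ = a₃ * s₀ - + 4 * a₄ * s₁
    c₄ = a₄ * s₀
    ring : ∀ a₀ a₁ a₂ a₃ a₄ s₀ s₁ s₂ s₃ s₄ →
      (a₀ * s₀ - a₁ * s₁ + a₂ * s₂ - a₃ * s₃ + a₄ * s₄) * s₀ +
      (a₁ * s₀ - + 2 * a₂ * s₁ + + 3 * a₃ * s₂ - + 4 * a₄ * s₃) * s₁ +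
      (a₂ * s₀ - + 3 * a₃ * s₁ + + 6 * a₄ * s₂) * s₂ + (a₃ * s₀ - + 4 * a₄ * s₁) * s₃ + a₄ * s₀ * s₄ ≡
      a₀ * (s₀ * s₀) + a₂ * (+ 2 * (s₀ * s₂ - s₁ * s₁)) + a₄ * (+ 2 * (s₀ * s₄) - + 8 * (s₁ * s₃) + + 6 * (s₂ * s₂))
    ring = solve-∀

  module _ {zs m₀ m₂ m₄} (moments : EvenMoments zs m₀ m₂ m₄) where

    ∑-vecs-suc-quartic : ∀ (F : Vec ℤ (suc n) → ℤ) (c₀ c₁ c₂ c₃ c₄ : Vec ℤ n → ℤ) →
      (∀ z d → F (z ∷ d) ≡ quartic (c₀ d) (c₁ d) (c₂ d) (c₃ d) (c₄ d) z) →
      ∑ (vecs (suc n) zs) F ≡ ∑ (vecs n zs) c₀ * m₀ + ∑ (vecs n zs) c₂ * m₂ + ∑ (vecs n zs) c₄ * m₄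
    ∑-vecs-suc-quartic {n} F c₀ c₁ c₂ c₃ c₄ expand = begin
      ∑ (vecs (suc n) zs) F
        ≡⟨ ∑-vecs-suc zs F ⟩
      ∑[ z ∈ zs ] ∑[ d ∈ V ] F (z ∷ d)
        ≡⟨ ∑-cong zs (λ z → trans (∑-cong V (expand z)) (∑-quartic-coefficients V c₀ c₁ c₂ c₃ c₄ z)) ⟩
      ∑[ z ∈ zs ] quartic (∑ V c₀) (∑ V c₁) (∑ V c₂) (∑ V c₃) (∑ V c₄) z
        ≡⟨ moments (∑ V c₀) (∑ V c₁) (∑ V c₂) (∑ V c₃) (∑ V c₄) ⟩
      ∑ V c₀ * m₀ + ∑ V c₂ * m₂ + ∑ V c₄ * m₄ ∎
      where
      open ≡-Reasoning
      V = vecs n zs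

    ∑-vecs-const : ∀ n c → ∑[ d ∈ vecs n zs ] c ≡ c * m₀ ^ n
    ∑-vecs-const zero    c = trans (ℤ.+-identityʳ c) (sym (ℤ.*-identityʳ c))
    ∑-vecs-const (suc n) c = begin
      ∑[ d ∈ vecs (suc n) zs ] c
        ≡⟨ ∑-vecs-suc-quartic (λ _ → c) (λ _ → c) zero′ zero′ zero′ zero′ (λ z _ → sym (const-quartic c z)) ⟩
      ∑ V (λ _ → c) * m₀ + ∑ V zero′ * m₂ + ∑ V zero′ * m₄
        ≡⟨ cong₂ (λ a b → a * m₀ + b * m₂ + b * m₄) (∑-vecs-const n c) (∑-zero V) ⟩
      c * m₀ ^ n * m₀ + + 0 * m₂ + + 0 * m₄
        ≡⟨ ring c m₀ (m₀ ^ n) m₂ m₄ ⟩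
      c * m₀ ^ suc n ∎
      where
      open ≡-Reasoning
      V = vecs n zs
      zero′ : Vec ℤ n → ℤ
      zero′ _ = + 0
      const-quartic : ∀ c z → c + + 0 * z + + 0 * (z * z) + + 0 * (z * z * z) + + 0 * (z * z * z * z) ≡ c
      const-quartic = solve-∀
      ring : ∀ c m₀ E m₂ m₄ → c * E * m₀ + + 0 * m₂ + + 0 * m₄ ≡ c * (m₀ * E)
      ring = solve-∀

    -- Multiplying by m₀ (by m₀ m₀ below) avoids the exponents n ∸ 1 and n ∸ 2, which truncate for small n.
    ∑-vecs-quadForm : ∀ n t u → m₀ * ∑ (vecs n zs) (quadForm t u) ≡ + n * (t + u) * m₂ * m₀ ^ n
    ∑-vecs-quadForm zero    t u = ring m₀ t u m₂
      where
      ring : ∀ m₀ t u m₂ → m₀ * (t * + 0 + u * (+ 0 * + 0) + + 0) ≡ + 0 * (t + u) * m₂ * + 1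
      ring = solve-∀
    ∑-vecs-quadForm (suc n) t u = begin
      m₀ * ∑ (vecs (suc n) zs) G
        ≡⟨ cong (m₀ *_) (∑-vecs-suc-quartic G G (λ d → + 2 * u * entrySum d) (λ _ → t + u) zero′ zero′
                           (λ z d → expand t u z (squareSum d) (entrySum d))) ⟩
      m₀ * (∑ V G * m₀ + ∑ V (λ _ → t + u) * m₂ + ∑ V zero′ * m₄)
        ≡⟨ cong₂ (λ a b → m₀ * (∑ V G * m₀ + a * m₂ + b * m₄)) (∑-vecs-const n (t + u)) (∑-zero V) ⟩
      m₀ * (∑ V G * m₀ + (t + u) * m₀ ^ n * m₂ + + 0 * m₄)
        ≡⟨ regroup m₀ (∑ V G) (t + u) (m₀ ^ n) m₂ m₄ ⟩
      m₀ * ∑ V G * m₀ + (t + u) * m₂ * m₀ ^ suc n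
        ≡⟨ cong (λ a → a * m₀ + (t + u) * m₂ * m₀ ^ suc n) (∑-vecs-quadForm n t u) ⟩
      + n * (t + u) * m₂ * m₀ ^ n * m₀ + (t + u) * m₂ * m₀ ^ suc n
        ≡⟨ collect (+ n) (t + u) m₂ m₀ (m₀ ^ n) ⟩
      + suc n * (t + u) * m₂ * m₀ ^ suc n ∎
      where
      open ≡-Reasoning
      G : ∀ {k} → Vec ℤ k → ℤ
      G = quadForm t u
      V = vecs n zs
      zero′ : Vec ℤ n → ℤ
      zero′ _ = + 0
      expand : ∀ t u z q s → t * (z * z + q) + u * ((z + s) * (z + s)) ≡
        (t * q + u * (s * s)) + + 2 * u * s * z + (t + u) * (z * z) + + 0 * (z * z * z) + + 0 * (z * z * z * z)
      expand = solve-∀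
      regroup : ∀ m₀ g v E m₂ m₄ → m₀ * (g * m₀ + v * E * m₂ + + 0 * m₄) ≡ m₀ * g * m₀ + v * m₂ * (m₀ * E)
      regroup = solve-∀
      collect : ∀ n v m₂ m₀ E → n * v * m₂ * E * m₀ + v * m₂ * (m₀ * E) ≡ (+ 1 + n) * v * m₂ * (m₀ * E)
      collect = solve-∀

    ∑-vecs-quadForm² : ∀ n t u →
      m₀ * m₀ * (∑[ d ∈ vecs n zs ] quadForm t u d * quadForm t u d) ≡
      (+ n * ((t + u) * (t + u)) * m₄ * m₀ + + n * (+ n - + 1) * ((t + u) * (t + u) + + 2 * (u * u)) * (m₂ * m₂))
        * m₀ ^ n
    ∑-vecs-quadForm² zero    t u = ring m₀ t u m₂ m₄
      where
      ring : ∀ m₀ t u m₂ m₄ → m₀ * m₀ * ((t * + 0 + u * (+ 0 * + 0)) * (t * + 0 + u * (+ 0 * + 0)) + + 0) ≡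
        (+ 0 * ((t + u) * (t + u)) * m₄ * m₀ + + 0 * (+ 0 - + 1) * ((t + u) * (t + u) + + 2 * (u * u)) * (m₂ * m₂)) * + 1
      ring = solve-∀
    ∑-vecs-quadForm² (suc n) t u = begin
      m₀ * m₀ * ∑ (vecs (suc n) zs) G²
        ≡⟨ cong (m₀ * m₀ *_) (∑-vecs-suc-quartic G² G² (λ d → + 4 * u * entrySum d * G d) G′
                                (λ d → + 4 * u * (t + u) * entrySum d) (λ _ → (t + u) * (t + u))
                                (λ z d → expand t u z (squareSum d) (entrySum d))) ⟩
      m₀ * m₀ * (∑ V G² * m₀ + ∑ V G′ * m₂ + ∑ V (λ _ → (t + u) * (t + u)) * m₄)
        ≡⟨ cong (λ a → m₀ * m₀ * (∑ V G² * m₀ + ∑ V G′ * m₂ + a * m₄)) (∑-vecs-const n ((t + u) * (t + u))) ⟩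
      m₀ * m₀ * (∑ V G² * m₀ + ∑ V G′ * m₂ + (t + u) * (t + u) * m₀ ^ n * m₄)
        ≡⟨ regroup m₀ (∑ V G²) (∑ V G′) (t + u) (m₀ ^ n) m₂ m₄ ⟩
      m₀ * m₀ * ∑ V G² * m₀ + m₀ * ∑ V G′ * m₀ * m₂ + (t + u) * (t + u) * m₄ * m₀ * m₀ ^ suc n
        ≡⟨ cong₂ (λ a b → a * m₀ + b * m₀ * m₂ + (t + u) * (t + u) * m₄ * m₀ * m₀ ^ suc n)
                 (∑-vecs-quadForm² n t u) (∑-vecs-quadForm n t′ u′) ⟩
      (+ n * ((t + u) * (t + u)) * m₄ * m₀ + + n * (+ n - + 1) * ((t + u) * (t + u) + + 2 * (u * u)) * (m₂ * m₂))
        * m₀ ^ n * m₀ + + n * (t′ + u′) * m₂ * m₀ ^ n * m₀ * m₂ + (t + u) * (t + u) * m₄ * m₀ * m₀ ^ suc n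
        ≡⟨ collect (+ n) t u m₀ m₂ m₄ (m₀ ^ n) ⟩
      (+ suc n * ((t + u) * (t + u)) * m₄ * m₀ + + suc n * (+ suc n - + 1) * ((t + u) * (t + u) + + 2 * (u * u)) * (m₂ * m₂))
        * m₀ ^ suc n ∎
      where
      open ≡-Reasoning
      t′ = + 2 * (t + u) * t
      u′ = + 2 * (t + u) * u + + 4 * (u * u)
      G : ∀ {k} → Vec ℤ k → ℤ
      G = quadForm t u
      -- The z² coefficient 4u²s² + 2(t + u)G of G(z ∷ d)² is again a quadratic form, so the first moment applies.
      G′ : Vec ℤ n → ℤ
      G′ = quadForm t′ u′
      G² : ∀ {k} → Vec ℤ k → ℤ
      G² d = G d * G d
      V = vecs n zs
      expand : ∀ t u z q s →
        let g = t * q + u * (s * s); g′ = + 2 * (t + u) * t * q + (+ 2 * (t + u) * u + + 4 * (u * u)) * (s * s) in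
        (t * (z * z + q) + u * ((z + s) * (z + s))) * (t * (z * z + q) + u * ((z + s) * (z + s))) ≡
        g * g + + 4 * u * s * g * z + g′ * (z * z) + + 4 * u * (t + u) * s * (z * z * z) + (t + u) * (t + u) * (z * z * z * z)
      expand = solve-∀
      regroup : ∀ m₀ b a v E m₂ m₄ → m₀ * m₀ * (b * m₀ + a * m₂ + v * v * E * m₄) ≡
        m₀ * m₀ * b * m₀ + m₀ * a * m₀ * m₂ + v * v * m₄ * m₀ * (m₀ * E)
      regroup = solve-∀
      collect : ∀ n t u m₀ m₂ m₄ E →
        let v = t + u; t′ = + 2 * v * t; u′ = + 2 * v * u + + 4 * (u * u) in
        (n * (v * v) * m₄ * m₀ + n * (n - + 1) * (v * v + + 2 * (u * u)) * (m₂ * m₂)) * E * m₀ +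
          n * (t′ + u′) * m₂ * E * m₀ * m₂ + v * v * m₄ * m₀ * (m₀ * E) ≡
        ((+ 1 + n) * (v * v) * m₄ * m₀ + (+ 1 + n) * ((+ 1 + n) - + 1) * (v * v + + 2 * (u * u)) * (m₂ * m₂)) * (m₀ * E)
      collect = solve-∀

  ∑-upTo-telescope : ∀ (F f : ℤ → ℤ) → (∀ x → F (x + + 1) - F x ≡ f x) →
                     ∀ a M → ∑[ k ∈ upTo M ] f (+ k - a) ≡ F (+ M - a) - F (- a)
  ∑-upTo-telescope F f step a zero = sym (begin
    F (+ 0 - a) - F (- a) ≡⟨ cong (λ x → F x - F (- a)) (ℤ.+-identityˡ (- a)) ⟩
    F (- a) - F (- a)     ≡⟨ ℤ.+-inverseʳ (F (- a)) ⟩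
    + 0                   ∎)
    where open ≡-Reasoning
  ∑-upTo-telescope F f step a (suc M) = begin
    ∑[ k ∈ upTo (suc M) ] f (+ k - a)
      ≡⟨ cong (λ ks → ∑[ k ∈ ks ] f (+ k - a)) (upTo-∷ʳ M) ⟨
    ∑[ k ∈ upTo M ∷ʳ M ] f (+ k - a)
      ≡⟨ ∑-++ (upTo M) (M ∷ []) (λ k → f (+ k - a)) ⟩
    ∑ (upTo M) (λ k → f (+ k - a)) + (f (+ M - a) + + 0)
      ≡⟨ cong₂ (λ s t → s + (t + + 0)) (∑-upTo-telescope F f step a M) (sym (step (+ M - a))) ⟩
    F (+ M - a) - F (- a) + (F (+ M - a + + 1) - F (+ M - a) + + 0)
      ≡⟨ cancel (F (+ M - a)) (F (- a)) (F (+ M - a + + 1)) ⟩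
    F (+ M - a + + 1) - F (- a)
      ≡⟨ cong (λ x → F x - F (- a)) (shift (+ M) a) ⟩
    F (+ suc M - a) - F (- a) ∎
    where
    open ≡-Reasoning
    cancel : ∀ x y z → x - y + (z - x + + 0) ≡ z - y
    cancel = solve-∀
    shift : ∀ m a → m - a + + 1 ≡ + 1 + m - a
    shift = solve-∀

  ∑-range-telescope : ∀ (F f : ℤ → ℤ) → (∀ x → F (x + + 1) - F x ≡ f x) →
                      ∀ N → ∑ (range N) f ≡ F (+ N + + 1) - F (- + N)
  ∑-range-telescope F f step N = begin
    ∑ (range N) f
      ≡⟨ ∑-map (λ k → + k - + N) (upTo (suc (2 ℕ.* N))) f ⟩
    ∑[ k ∈ upTo (suc (2 ℕ.* N)) ] f (+ k - + N)
      ≡⟨ ∑-upTo-telescope F f step (+ N) (suc (2 ℕ.* N)) ⟩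
    F (+ suc (2 ℕ.* N) - + N) - F (- + N)
      ≡⟨ cong (λ x → F (+ 1 + x - + N) - F (- + N)) (ℤ.pos-* 2 N) ⟩
    F (+ 1 + + 2 * + N - + N) - F (- + N)
      ≡⟨ cong (λ x → F x - F (- + N)) (ring (+ N)) ⟩
    F (+ N + + 1) - F (- + N) ∎
    where
    open ≡-Reasoning
    ring : ∀ n → + 1 + + 2 * n - n ≡ n + + 1
    ring = solve-∀

  module _ (N : ℕ) where

    L w s₂ s₄ m₀ m₂ m₄ : ℤ
    L  = + suc (2 ℕ.* N)
    w  = + N * (+ N + + 1)
    s₂ = ∑[ x ∈ range N ] x * x
    s₄ = ∑[ x ∈ range N ] x * x * x * x
    m₀ = L * L
    m₂ = + 2 * (L * s₂)
    m₄ = + 2 * (L * s₄) + + 6 * (s₂ * s₂)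

    m₀≢0 : m₀ ≢ + 0
    m₀≢0 ()

    private
      2N+1≡L : + 2 * + N + + 1 ≡ L
      2N+1≡L = trans (cong (λ x → x + + 1) (sym (ℤ.pos-* 2 N))) (ℤ.+-comm (+ (2 ℕ.* N)) (+ 1))

    c*∑-range : ∀ c (F f : ℤ → ℤ) → (∀ x → F (x + + 1) - F x ≡ c * f x) →
                c * ∑ (range N) f ≡ F (+ N + + 1) - F (- + N)
    c*∑-range c F f step = trans (*-distribˡ-∑ c (range N) f) (∑-range-telescope F (λ x → c * f x) step N)

    ∑-range-1 : ∑[ x ∈ range N ] + 1 ≡ L
    ∑-range-1 = trans (∑-const (range N) (+ 1))
      (trans (ℤ.*-identityʳ _) (cong +_ (trans (length-map (λ k → + k - + N) (upTo (suc (2 ℕ.* N)))) (length-upTo _))))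

    ∑-range-x : ∑[ x ∈ range N ] x ≡ + 0
    ∑-range-x = ℤ.*-cancelˡ-≡ (+ 2) _ (+ 0) (trans (c*∑-range (+ 2) (λ x → x * (x - + 1)) (λ x → x) step) (ends (+ N)))
      where
      step : ∀ x → (x + + 1) * (x + + 1 - + 1) - x * (x - + 1) ≡ + 2 * x
      step = solve-∀
      ends : ∀ n → (n + + 1) * (n + + 1 - + 1) - (- n) * (- n - + 1) ≡ + 2 * + 0
      ends = solve-∀

    ∑-range-x² : + 6 * s₂ ≡ + 2 * w * L
    ∑-range-x² = trans (c*∑-range (+ 6) (λ x → x * (x - + 1) * (+ 2 * x - + 1)) (λ x → x * x) step)
                       (trans (ends (+ N)) (cong (λ x → + 2 * w * x) 2N+1≡L))
      where
      step : ∀ x → (x + + 1) * (x + + 1 - + 1) * (+ 2 * (x + + 1) - + 1) - x * (x - + 1) * (+ 2 * x - + 1) ≡ + 6 * (x * x)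
      step = solve-∀
      ends : ∀ n → (n + + 1) * (n + + 1 - + 1) * (+ 2 * (n + + 1) - + 1) - (- n) * (- n - + 1) * (+ 2 * (- n) - + 1) ≡
                   + 2 * (n * (n + + 1)) * (+ 2 * n + + 1)
      ends = solve-∀

    ∑-range-x³ : ∑[ x ∈ range N ] x * x * x ≡ + 0
    ∑-range-x³ = ℤ.*-cancelˡ-≡ (+ 4) _ (+ 0)
      (trans (c*∑-range (+ 4) (λ x → x * (x - + 1) * (x * (x - + 1))) (λ x → x * x * x) step) (ends (+ N)))
      where
      step : ∀ x → (x + + 1) * (x + + 1 - + 1) * ((x + + 1) * (x + + 1 - + 1)) - x * (x - + 1) * (x * (x - + 1)) ≡
                   + 4 * (x * x * x)
      step = solve-∀
      ends : ∀ n → (n + + 1) * (n + + 1 - + 1) * ((n + + 1) * (n + + 1 - + 1)) - (- n) * (- n - + 1) * ((- n) * (- n - + 1)) ≡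
                   + 4 * + 0
      ends = solve-∀

    ∑-range-x⁴ : + 30 * s₄ ≡ + 2 * w * L * (+ 3 * w - + 1)
    ∑-range-x⁴ = trans (c*∑-range (+ 30) F (λ x → x * x * x * x) step)
                       (trans (ends (+ N)) (cong (λ x → + 2 * w * x * (+ 3 * w - + 1)) 2N+1≡L))
      where
      F : ℤ → ℤ
      F x = x * (x - + 1) * (+ 2 * x - + 1) * (+ 3 * x * x - + 3 * x - + 1)
      step : ∀ x → let y = x + + 1 in
        y * (y - + 1) * (+ 2 * y - + 1) * (+ 3 * y * y - + 3 * y - + 1) -
        x * (x - + 1) * (+ 2 * x - + 1) * (+ 3 * x * x - + 3 * x - + 1) ≡ + 30 * (x * x * x * x)
      step = solve-∀
      ends : ∀ n → let y = n + + 1; z = - n in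
        y * (y - + 1) * (+ 2 * y - + 1) * (+ 3 * y * y - + 3 * y - + 1) -
        z * (z - + 1) * (+ 2 * z - + 1) * (+ 3 * z * z - + 3 * z - + 1) ≡
        + 2 * (n * (n + + 1)) * (+ 2 * n + + 1) * (+ 3 * (n * (n + + 1)) - + 1)
      ends = solve-∀

    range-evenMoments : EvenMoments (differences (range N)) m₀ m₂ m₄
    range-evenMoments a₀ a₁ a₂ a₃ a₄ =
      trans (differences-evenMoments (range N) a₀ a₁ a₂ a₃ a₄)
            (simplify a₀ a₂ a₄ _ L _ s₂ _ s₄ m₀ m₂ m₄ ∑-range-1 ∑-range-x ∑-range-x³ refl refl refl)
      where
      simplify : ∀ a₀ a₂ a₄ s₀ L s₁ s₂ s₃ s₄ m₀ m₂ m₄ → s₀ ≡ L → s₁ ≡ + 0 → s₃ ≡ + 0 →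
        m₀ ≡ L * L → m₂ ≡ + 2 * (L * s₂) → m₄ ≡ + 2 * (L * s₄) + + 6 * (s₂ * s₂) →
        a₀ * (s₀ * s₀) + a₂ * (+ 2 * (s₀ * s₂ - s₁ * s₁)) + a₄ * (+ 2 * (s₀ * s₄) - + 8 * (s₁ * s₃) + + 6 * (s₂ * s₂)) ≡
        a₀ * m₀ + a₂ * m₂ + a₄ * m₄
      simplify a₀ a₂ a₄ s₀ _ _ s₂ _ s₄ _ _ _ refl refl refl refl refl refl = ring a₀ a₂ a₄ s₀ s₂ s₄
        where
        ring : ∀ a₀ a₂ a₄ s₀ s₂ s₄ →
          a₀ * (s₀ * s₀) + a₂ * (+ 2 * (s₀ * s₂ - + 0 * + 0)) + a₄ * (+ 2 * (s₀ * s₄) - + 8 * (+ 0 * + 0) + + 6 * (s₂ * s₂)) ≡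
          a₀ * (s₀ * s₀) + a₂ * (+ 2 * (s₀ * s₂)) + a₄ * (+ 2 * (s₀ * s₄) + + 6 * (s₂ * s₂))
        ring = solve-∀

  closedFormNumerator : ℤ → ℤ → ℤ
  closedFormNumerator q N =
    + 2 * N * (N + + 1) * (q - + 1)
      * ((+ 2 * N ^ 2 + + 2 * N) * (+ 5 * q ^ 5 - + 8 * q ^ 4 + q ^ 3 + + 8 * q ^ 2 - + 21 * q - + 18)
         - + 3 * (q ^ 2 - q - + 1) ^ 2)

  closedFormNumerator-via-moments : ∀ (n P N t u w : ℤ) →
    P ≡ + 1 + n → t ≡ P * P → u ≡ - (P + + 1) → w ≡ N * (N + + 1) →
    closedFormNumerator P N ≡
    + 6 * n * ((t + u) * (t + u)) * w * (+ 8 * w - + 1) + + 20 * n * (n - + 1) * ((t + u) * (t + u) + + 2 * (u * u)) * (w * w)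
  closedFormNumerator-via-moments n _ N _ _ _ refl refl refl refl = expand n N
    where
    expand : ∀ n N →
      let P = + 1 + n; t = P * P; u = - (P + + 1); w = N * (N + + 1)
          N² = N * (N * + 1); P² = P * (P * + 1); P³ = P * P²; P⁴ = P * P³; P⁵ = P * P⁴ in
      + 2 * N * (N + + 1) * (P - + 1)
        * ((+ 2 * N² + + 2 * N) * (+ 5 * P⁵ - + 8 * P⁴ + P³ + + 8 * P² - + 21 * P - + 18)
           - + 3 * ((P² - P - + 1) * ((P² - P - + 1) * + 1)))
      ≡ + 6 * n * ((t + u) * (t + u)) * w * (+ 8 * w - + 1) + + 20 * n * (n - + 1) * ((t + u) * (t + u) + + 2 * (u * u)) * (w * w)
    expand = solve-∀

  -- Scaled by 90 so that s₂ and s₄ enter only through 6 s₂ and 30 s₄, the values found by telescoping.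
  moments-to-numerator : ∀ (n t u L s₂ s₄ w m₀ m₂ m₄ : ℤ) →
    m₀ ≡ L * L → m₂ ≡ + 2 * (L * s₂) → m₄ ≡ + 2 * (L * s₄) + + 6 * (s₂ * s₂) →
    + 6 * s₂ ≡ + 2 * w * L → + 30 * s₄ ≡ + 2 * w * L * (+ 3 * w - + 1) →
    + 90 * (n * ((t + u) * (t + u)) * m₄ * m₀ + n * (n - + 1) * ((t + u) * (t + u) + + 2 * (u * u)) * (m₂ * m₂)) ≡
    + 2 * (m₀ * m₀) *
      (+ 6 * n * ((t + u) * (t + u)) * w * (+ 8 * w - + 1) + + 20 * n * (n - + 1) * ((t + u) * (t + u) + + 2 * (u * u)) * (w * w))
  moments-to-numerator n t u L s₂ s₄ w _ _ _ refl refl refl 6s₂≡ 30s₄≡ = begin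
    _                                               ≡⟨ regroup n t u L s₂ s₄ ⟩
    F (+ 6 * s₂) (+ 30 * s₄)                        ≡⟨ cong₂ F 6s₂≡ 30s₄≡ ⟩
    F (+ 2 * w * L) (+ 2 * w * L * (+ 3 * w - + 1)) ≡⟨ collect n t u L w ⟩
    _                                               ∎
    where
    open ≡-Reasoning
    F : ℤ → ℤ → ℤ
    F S₂ S₄ = let v = t + u; c = v * v + + 2 * (u * u) in
              L * L * (n * (v * v) * (+ 6 * L * S₄ + + 15 * (S₂ * S₂)) + + 10 * n * (n - + 1) * c * (S₂ * S₂))
    regroup : ∀ n t u L s₂ s₄ →
      let m₀ = L * L; m₂ = + 2 * (L * s₂); m₄ = + 2 * (L * s₄) + + 6 * (s₂ * s₂); v = t + u; c = v * v + + 2 * (u * u)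
          S₂ = + 6 * s₂; S₄ = + 30 * s₄ in
      + 90 * (n * (v * v) * m₄ * m₀ + n * (n - + 1) * c * (m₂ * m₂)) ≡
      L * L * (n * (v * v) * (+ 6 * L * S₄ + + 15 * (S₂ * S₂)) + + 10 * n * (n - + 1) * c * (S₂ * S₂))
    regroup = solve-∀
    collect : ∀ n t u L w →
      let v = t + u; c = v * v + + 2 * (u * u); S₂ = + 2 * w * L; S₄ = S₂ * (+ 3 * w - + 1) in
      L * L * (n * (v * v) * (+ 6 * L * S₄ + + 15 * (S₂ * S₂)) + + 10 * n * (n - + 1) * c * (S₂ * S₂)) ≡
      + 2 * (L * L * (L * L)) * (+ 6 * n * (v * v) * w * (+ 8 * w - + 1) + + 20 * n * (n - + 1) * c * (w * w))
    collect = solve-∀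

  cancel-2m₀² : ∀ m₀ S R X E .{{_ : ℤ.NonZero (+ 2 * (m₀ * m₀))}} →
    m₀ * m₀ * S ≡ R * E → + 90 * R ≡ + 2 * (m₀ * m₀) * X → S * + 45 ≡ X * E
  cancel-2m₀² m₀ S R X E moment numerator = ℤ.*-cancelˡ-≡ (+ 2 * (m₀ * m₀)) _ _ (begin
    + 2 * (m₀ * m₀) * (S * + 45) ≡⟨ ring (m₀ * m₀) S ⟩
    + 90 * (m₀ * m₀ * S)         ≡⟨ cong (+ 90 *_) moment ⟩
    + 90 * (R * E)               ≡⟨ ℤ.*-assoc (+ 90) R E ⟨
    + 90 * R * E                 ≡⟨ cong (_* E) numerator ⟩
    + 2 * (m₀ * m₀) * X * E      ≡⟨ ℤ.*-assoc (+ 2 * (m₀ * m₀)) X E ⟩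
    + 2 * (m₀ * m₀) * (X * E)    ∎)
    where
    open ≡-Reasoning
    ring : ∀ a S → + 2 * a * (S * + 45) ≡ + 90 * (a * S)
    ring = solve-∀

  avg≡/45 : ∀ S X k → S * + 45 ≡ X * + k → k ≢ 0 → avg S k ≡ X ℚ./ 45
  avg≡/45 S X zero    eq k≢0 = ⊥-elim (k≢0 refl)
  avg≡/45 S X (suc k) eq _   = ℚ.fromℚᵘ-cong {mkℚᵘ S k} {mkℚᵘ X 44} (*≡* eq)

  module _ (n N : ℕ) where

    private
      P t u : ℤ
      P = + suc n
      t = P * P
      u = - (P + + 1)
      Bs = B (suc n) N
      k = cardB (suc n) N

    sumD4≡∑quadForm² : sumD4 (suc n) N ≡ ∑[ d ∈ vecs n (differences (range N)) ] quadForm t u d * quadForm t u d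
    sumD4≡∑quadForm² = begin
      foldr _+_ (+ 0) (concatMap (λ a → map (dist4 (suc n) a) Bs) Bs)
        ≡⟨ foldr-+≡∑ (concatMap (λ a → map (dist4 (suc n) a) Bs) Bs) ⟩
      ∑[ x ∈ concatMap (λ a → map (dist4 (suc n) a) Bs) Bs ] x
        ≡⟨ ∑-concatMap (λ a → map (dist4 (suc n) a) Bs) Bs (λ x → x) ⟩
      ∑[ a ∈ Bs ] ∑[ x ∈ map (dist4 (suc n) a) Bs ] x
        ≡⟨ ∑-cong Bs (λ a → ∑-map (dist4 (suc n) a) Bs (λ x → x)) ⟩
      ∑[ a ∈ Bs ] ∑[ b ∈ Bs ] dist4 (suc n) a b
        ≡⟨ ∑-cong Bs (λ a → ∑-cong Bs (λ b → cong (λ s → s * s) (normSq≡quadForm (zipWith _-_ a b)))) ⟩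
      ∑[ a ∈ Bs ] ∑[ b ∈ Bs ] quadForm t u (zipWith _-_ a b) * quadForm t u (zipWith _-_ a b)
        ≡⟨ ∑²-vecs-differences n (range N) (λ d → quadForm t u d * quadForm t u d) ⟩
      ∑[ d ∈ vecs n (differences (range N)) ] quadForm t u d * quadForm t u d ∎
      where open ≡-Reasoning

    cardB²≡m₀^n : + (k ℕ.* k) ≡ m₀ N ^ n
    cardB²≡m₀^n = begin
      + (k ℕ.* k)                                  ≡⟨ ℤ.pos-* k k ⟩
      + k * + k                                    ≡⟨ cong (_* + k) (ℤ.*-identityʳ (+ k)) ⟨
      + k * + 1 * + k                              ≡⟨ ℤ.*-comm (+ k * + 1) (+ k) ⟩
      + k * (+ k * + 1)                            ≡⟨ ∑-const Bs (+ k * + 1) ⟨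
      ∑[ a ∈ Bs ] + k * + 1                        ≡⟨ ∑-cong Bs (λ _ → ∑-const Bs (+ 1)) ⟨
      ∑[ a ∈ Bs ] ∑[ b ∈ Bs ] + 1                  ≡⟨ ∑²-vecs-differences n (range N) (λ _ → + 1) ⟩
      ∑[ d ∈ vecs n (differences (range N)) ] + 1  ≡⟨ ∑-vecs-const (range-evenMoments N) n (+ 1) ⟩
      + 1 * m₀ N ^ n                               ≡⟨ ℤ.*-identityˡ _ ⟩
      m₀ N ^ n                                     ∎
      where open ≡-Reasoning

    M4≡closedForm : M4 (suc n) N ≡ closedForm (suc n) N
    M4≡closedForm = avg≡/45 (sumD4 (suc n) N) X (k ℕ.* k) sumD4*45≡X*cardB²
      (λ k²≡0 → m₀≢0 N (ℤ.i^n≡0⇒i≡0 (m₀ N) n (trans (sym cardB²≡m₀^n) (cong +_ k²≡0))))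
      where
      X = closedFormNumerator P (+ N)
      sumD4*45≡X*cardB² : sumD4 (suc n) N * + 45 ≡ X * + (k ℕ.* k)
      sumD4*45≡X*cardB² = trans
        (cancel-2m₀² (m₀ N) _ _ X (m₀ N ^ n)
          (trans (cong (m₀ N * m₀ N *_) sumD4≡∑quadForm²) (∑-vecs-quadForm² (range-evenMoments N) n t u))
          (trans (moments-to-numerator (+ n) t u (L N) (s₂ N) (s₄ N) (w N) (m₀ N) (m₂ N) (m₄ N) refl refl refl
                                       (∑-range-x² N) (∑-range-x⁴ N))
                 (cong (+ 2 * (m₀ N * m₀ N) *_) (sym (closedFormNumerator-via-moments (+ n) P (+ N) t u (w N) refl refl refl refl)))))
        (cong (X *_) (sym cardB²≡m₀^n))

module Estimate where

  open ExactValue using (closedFormNumerator)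
  open import Data.Integer as ℤ using (ℤ; +_; _+_; _*_; _-_; -_; _^_)
  open import Data.Integer.Properties as ℤ using ()
  open import Data.Integer.Tactic.RingSolver using (solve-∀)
  open import Data.List using (List; []; _∷_)
  open import Data.List.Relation.Unary.All using (All; []; _∷_; all?)
  open import Data.Nat as ℕ using (ℕ; zero; suc; _≤_; _≤?_; z≤n)
  open import Data.Nat.Properties as ℕ using ()
  open import Data.Product using (_×_; _,_)
  open import Data.Rational as ℚ using (_/_; ∣_∣)
  open import Data.Rational.Properties as ℚ using ()
  open import Data.Rational.Unnormalised as ℚᵘ using (mkℚᵘ; *≤*)
  open import Data.Rational.Unnormalised.Properties as ℚᵘ using ()
  open import Data.Sum using (_⊎_; inj₁; inj₂)
  open import Relation.Binary.PropositionalEquality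
  open import Relation.Nullary.Decidable using (from-yes; _×-dec_; _⊎-dec_)
  open import Relation.Unary using (Decidable)

  -- (c , a , b) stands for c · p ^ a · N ^ b.
  Monomial : Set
  Monomial = ℕ × ℕ × ℕ

  ⟦_⟧ : List Monomial → ℕ → ℕ → ℕ
  ⟦ []              ⟧ p N = 0
  ⟦ (c , a , b) ∷ ms ⟧ p N = c ℕ.* (p ℕ.^ a ℕ.* N ℕ.^ b) ℕ.+ ⟦ ms ⟧ p N

  ⟦_⟧ℤ : List Monomial → ℤ → ℤ → ℤ
  ⟦ []              ⟧ℤ p N = + 0
  ⟦ (c , a , b) ∷ ms ⟧ℤ p N = + c * (p ^ a * N ^ b) + ⟦ ms ⟧ℤ p N

  coefficientSum : List Monomial → ℕ
  coefficientSum []              = 0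
  coefficientSum ((c , _ , _) ∷ ms) = c ℕ.+ coefficientSum ms

  pos-^ : ∀ m k → + (m ℕ.^ k) ≡ (+ m) ^ k
  pos-^ m zero    = refl
  pos-^ m (suc k) = trans (ℤ.pos-* m (m ℕ.^ k)) (cong (+ m *_) (pos-^ m k))

  pos-monomial : ∀ p N a b → + (p ℕ.^ a ℕ.* N ℕ.^ b) ≡ (+ p) ^ a * (+ N) ^ b
  pos-monomial p N a b = trans (ℤ.pos-* (p ℕ.^ a) (N ℕ.^ b)) (cong₂ _*_ (pos-^ p a) (pos-^ N b))

  pos-⟦⟧ : ∀ ms p N → + ⟦ ms ⟧ p N ≡ ⟦ ms ⟧ℤ (+ p) (+ N)
  pos-⟦⟧ []               p N = refl
  pos-⟦⟧ ((c , a , b) ∷ ms) p N =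
    trans (ℤ.pos-+ (c ℕ.* (p ℕ.^ a ℕ.* N ℕ.^ b)) (⟦ ms ⟧ p N))
          (cong₂ _+_ (trans (ℤ.pos-* c _) (cong (+ c *_) (pos-monomial p N a b))) (pos-⟦⟧ ms p N))

  leading : ℕ → ℕ → ℕ
  leading p N = p ℕ.^ 5 ℕ.* N ℕ.^ 4 ℕ.+ p ℕ.^ 6 ℕ.* N ℕ.^ 3

  Dominated : Monomial → Set
  Dominated (_ , a , b) = a ≤ 5 × b ≤ 4 ⊎ a ≤ 6 × b ≤ 3

  dominated? : Decidable Dominated
  dominated? (_ , a , b) = (a ≤? 5 ×-dec b ≤? 4) ⊎-dec (a ≤? 6 ×-dec b ≤? 3)

  monomial≤leading : ∀ p N {c} a b → Dominated (c , a , b) →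
                     suc p ℕ.^ a ℕ.* suc N ℕ.^ b ≤ leading (suc p) (suc N)
  monomial≤leading p N a b (inj₁ (a≤5 , b≤4)) =
    ℕ.≤-trans (ℕ.*-mono-≤ (ℕ.^-monoʳ-≤ (suc p) a≤5) (ℕ.^-monoʳ-≤ (suc N) b≤4))
              (ℕ.m≤m+n (suc p ℕ.^ 5 ℕ.* suc N ℕ.^ 4) (suc p ℕ.^ 6 ℕ.* suc N ℕ.^ 3))
  monomial≤leading p N a b (inj₂ (a≤6 , b≤3)) =
    ℕ.≤-trans (ℕ.*-mono-≤ (ℕ.^-monoʳ-≤ (suc p) a≤6) (ℕ.^-monoʳ-≤ (suc N) b≤3))
              (ℕ.m≤n+m (suc p ℕ.^ 6 ℕ.* suc N ℕ.^ 3) (suc p ℕ.^ 5 ℕ.* suc N ℕ.^ 4))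

  ⟦⟧≤leading : ∀ p N {ms} → All Dominated ms → ⟦ ms ⟧ (suc p) (suc N) ≤ coefficientSum ms ℕ.* leading (suc p) (suc N)
  ⟦⟧≤leading p N []                         = z≤n
  ⟦⟧≤leading p N {(c , a , b) ∷ ms} (d ∷ ds) = ℕ.≤-trans
    (ℕ.+-mono-≤ (ℕ.*-monoʳ-≤ c (monomial≤leading p N {c} a b d)) (⟦⟧≤leading p N ds))
    (ℕ.≤-reflexive (sym (ℕ.*-distribʳ-+ (leading (suc p) (suc N)) c (coefficientSum ms))))

  positivePart negativePart : List Monomial
  positivePart = (6 , 0 , 1) ∷ (78 , 0 , 2) ∷ (144 , 0 , 3) ∷ (72 , 0 , 4) ∷ (6 , 1 , 1) ∷ (18 , 1 , 2) ∷
    (24 , 1 , 3) ∷ (12 , 1 , 4) ∷ (22 , 3 , 2) ∷ (56 , 3 , 3) ∷ (28 , 3 , 4) ∷ (18 , 4 , 1) ∷ (54 , 4 , 2) ∷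
    (72 , 4 , 3) ∷ (36 , 4 , 4) ∷ (20 , 6 , 2) ∷ (40 , 6 , 3) ∷ []
  negativePart = (18 , 2 , 1) ∷ (134 , 2 , 2) ∷ (232 , 2 , 3) ∷ (116 , 2 , 4) ∷ (6 , 3 , 1) ∷ (6 , 5 , 1) ∷
    (58 , 5 , 2) ∷ (104 , 5 , 3) ∷ (52 , 5 , 4) ∷ []

  numerator-expansion : ∀ p N → closedFormNumerator p N - + 20 * (p ^ 6 * N ^ 4) ≡
                                ⟦ positivePart ⟧ℤ p N - ⟦ negativePart ⟧ℤ p N
  numerator-expansion = expanded
    where
    expanded : ∀ p N →
      let p⁰ = + 1; p¹ = p * p⁰; p² = p * p¹; p³ = p * p²; p⁴ = p * p³; p⁵ = p * p⁴; p⁶ = p * p⁵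
          N⁰ = + 1; N¹ = N * N⁰; N² = N * N¹; N³ = N * N²; N⁴ = N * N³ in
      + 2 * N * (N + + 1) * (p - + 1)
        * ((+ 2 * N² + + 2 * N) * (+ 5 * p⁵ - + 8 * p⁴ + p³ + + 8 * p² - + 21 * p - + 18)
           - + 3 * ((p² - p - + 1) * ((p² - p - + 1) * + 1)))
        - + 20 * (p⁶ * N⁴) ≡
      (+ 6 * (p⁰ * N¹) + (+ 78 * (p⁰ * N²) + (+ 144 * (p⁰ * N³) + (+ 72 * (p⁰ * N⁴) + (+ 6 * (p¹ * N¹) +
        (+ 18 * (p¹ * N²) + (+ 24 * (p¹ * N³) + (+ 12 * (p¹ * N⁴) + (+ 22 * (p³ * N²) + (+ 56 * (p³ * N³) +
        (+ 28 * (p³ * N⁴) + (+ 18 * (p⁴ * N¹) + (+ 54 * (p⁴ * N²) + (+ 72 * (p⁴ * N³) + (+ 36 * (p⁴ * N⁴) +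
        (+ 20 * (p⁶ * N²) + (+ 40 * (p⁶ * N³) + (+ 0))))))))))))))))))
      - (+ 18 * (p² * N¹) + (+ 134 * (p² * N²) + (+ 232 * (p² * N³) + (+ 116 * (p² * N⁴) + (+ 6 * (p³ * N¹) +
        (+ 6 * (p⁵ * N¹) + (+ 58 * (p⁵ * N²) + (+ 104 * (p⁵ * N³) + (+ 52 * (p⁵ * N⁴) + (+ 0))))))))))
    expanded = solve-∀

  /45-4/9-bound : ∀ X M K → ℤ.∣ X - + 20 * + M ∣ ≤ 45 ℕ.* K →
                  ∣ X / 45 ℚ.- (+ 4 / 9) ℚ.* (+ M / 1) ∣ ℚ.≤ + K / 1
  /45-4/9-bound X M K bound = ℚ.toℚᵘ-cancel-≤
    (ℚᵘ.≤-respˡ-≃ (ℚᵘ.≃-sym lhs≃) (ℚᵘ.≤-respʳ-≃ (ℚᵘ.≃-sym (ℚ.toℚᵘ-fromℚᵘ (mkℚᵘ (+ K) 0))) (*≤* cross)))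
    where
    x = mkℚᵘ X 44
    c = mkℚᵘ (+ 4) 8
    m = mkℚᵘ (+ M) 0
    cm≃ : ℚ.toℚᵘ ((+ 4 / 9) ℚ.* (+ M / 1)) ℚᵘ.≃ c ℚᵘ.* m
    cm≃ = ℚᵘ.≃-trans (ℚ.toℚᵘ-homo-* (+ 4 / 9) (+ M / 1)) (ℚᵘ.*-cong (ℚ.toℚᵘ-fromℚᵘ c) (ℚ.toℚᵘ-fromℚᵘ m))
    lhs≃ : ℚ.toℚᵘ ∣ X / 45 ℚ.- (+ 4 / 9) ℚ.* (+ M / 1) ∣ ℚᵘ.≃ ℚᵘ.∣ x ℚᵘ.- c ℚᵘ.* m ∣
    lhs≃ = ℚᵘ.≃-trans (ℚ.toℚᵘ-homo-∣-∣ _) (ℚᵘ.∣-∣-cong (ℚᵘ.≃-trans (ℚ.toℚᵘ-homo-+ (X / 45) _)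
             (ℚᵘ.+-cong (ℚ.toℚᵘ-fromℚᵘ x) (ℚᵘ.≃-trans (ℚ.toℚᵘ-homo‿- _) (ℚᵘ.-‿cong cm≃)))))
    -- ℚᵘ's definition of ∣ x − c m ∣ ≤ K / 1, with both sides multiplied out.
    cross : + ℤ.∣ X * + 9 + - (+ 4 * + M) * + 45 ∣ * + 1 ℤ.≤ + K * + 405
    cross = begin
      + ℤ.∣ X * + 9 + - (+ 4 * + M) * + 45 ∣ * + 1 ≡⟨ ℤ.*-identityʳ _ ⟩
      + ℤ.∣ X * + 9 + - (+ 4 * + M) * + 45 ∣       ≡⟨ cong (λ z → + ℤ.∣ z ∣) (ring X (+ M)) ⟩
      + ℤ.∣ + 9 * (X - + 20 * + M) ∣              ≡⟨ cong +_ (ℤ.abs-* (+ 9) (X - + 20 * + M)) ⟩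
      + (9 ℕ.* ℤ.∣ X - + 20 * + M ∣)              ≤⟨ ℤ.+≤+ (ℕ.*-monoʳ-≤ 9 bound) ⟩
      + (9 ℕ.* (45 ℕ.* K))                         ≡⟨ cong +_ (trans (sym (ℕ.*-assoc 9 45 K)) (ℕ.*-comm 405 K)) ⟩
      + (K ℕ.* 405)                                ≡⟨ ℤ.pos-* K 405 ⟩
      + K * + 405                                  ∎
      where
      open ℤ.≤-Reasoning
      ring : ∀ X M → X * + 9 + - (+ 4 * M) * + 45 ≡ + 9 * (X - + 20 * M)
      ring = solve-∀

  closedForm-estimate : ∀ p N →
    ∣ closedForm (suc p) (suc N) ℚ.- (+ 4 / 9) ℚ.* (+ (suc p ℕ.^ 6 ℕ.* suc N ℕ.^ 4) / 1) ∣ ℚ.≤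
    + (32 ℕ.* leading (suc p) (suc N)) / 1
  closedForm-estimate p N = /45-4/9-bound X M (32 ℕ.* A) (begin
    ℤ.∣ X - + 20 * + M ∣
      ≡⟨ cong (λ m → ℤ.∣ X - + 20 * m ∣) (pos-monomial (suc p) (suc N) 6 4) ⟩
    ℤ.∣ X - + 20 * ((+ suc p) ^ 6 * (+ suc N) ^ 4) ∣
      ≡⟨ cong ℤ.∣_∣ (numerator-expansion (+ suc p) (+ suc N)) ⟩
    ℤ.∣ ⟦ positivePart ⟧ℤ (+ suc p) (+ suc N) - ⟦ negativePart ⟧ℤ (+ suc p) (+ suc N) ∣
      ≡⟨ cong₂ (λ a b → ℤ.∣ a - b ∣) (pos-⟦⟧ positivePart (suc p) (suc N)) (pos-⟦⟧ negativePart (suc p) (suc N)) ⟨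
    ℤ.∣ + ⟦ positivePart ⟧ (suc p) (suc N) - + ⟦ negativePart ⟧ (suc p) (suc N) ∣
      ≤⟨ ℤ.∣i-j∣≤∣i∣+∣j∣ (+ ⟦ positivePart ⟧ (suc p) (suc N)) (+ ⟦ negativePart ⟧ (suc p) (suc N)) ⟩
    ⟦ positivePart ⟧ (suc p) (suc N) ℕ.+ ⟦ negativePart ⟧ (suc p) (suc N)
      ≤⟨ ℕ.+-mono-≤ (⟦⟧≤leading p N (from-yes (all? dominated? positivePart)))
                    (⟦⟧≤leading p N (from-yes (all? dominated? negativePart))) ⟩
    coefficientSum positivePart ℕ.* A ℕ.+ coefficientSum negativePart ℕ.* A
      ≡⟨ ℕ.*-distribʳ-+ A (coefficientSum positivePart) (coefficientSum negativePart) ⟨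
    1432 ℕ.* A
      ≤⟨ ℕ.*-monoˡ-≤ A (ℕ.m≤m+n 1432 8) ⟩
    1440 ℕ.* A
      ≡⟨ ℕ.*-assoc 45 32 A ⟩
    45 ℕ.* (32 ℕ.* A) ∎)
    where
    open ℕ.≤-Reasoning
    X = closedFormNumerator (+ suc p) (+ suc N)
    M = suc p ℕ.^ 6 ℕ.* suc N ℕ.^ 4
    A = leading (suc p) (suc N)

open ExactValue using (M4≡closedForm)
open Estimate using (closedForm-estimate)

open import Data.Nat using (ℕ; _≤_; _^_; _*_; _+_; zero; suc)
open import Data.Nat.Primality using (Prime; ¬prime[0])
open import Data.Integer using (+_)
open import Data.Rational as ℚ using (ℚ; _/_; ∣_∣)
open import Data.Product using (_×_; ∃; _,_)
open import Data.Empty using (⊥-elim)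
open import Relation.Binary.PropositionalEquality using (_≡_; _≢_)

-- Primality only rules out p = 0: both parts hold for every p ≥ 1, p = 2 included.
lemma6p5 :
    (∀ (p N : ℕ) → Prime p → p ≢ 2 → 1 ≤ N → M4 p N ≡ closedForm p N)
    × ∃ λ (C : ℕ) → ∀ (p N : ℕ) → Prime p → p ≢ 2 → 1 ≤ N →
        ∣ closedForm p N ℚ.- (+ 4 / 9) ℚ.* (+ (p ^ 6 * N ^ 4) / 1) ∣
          ℚ.≤ + (C * (p ^ 5 * N ^ 4 + p ^ 6 * N ^ 3)) / 1
lemma6p5 = exact , 32 , estimate
  where
  exact : ∀ p N → Prime p → p ≢ 2 → 1 ≤ N → M4 p N ≡ closedForm p N
  exact zero    N prime[0] _ _ = ⊥-elim (¬prime[0] prime[0])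
  exact (suc n) N _        _ _ = M4≡closedForm n N
  estimate : ∀ p N → Prime p → p ≢ 2 → 1 ≤ N →
             ∣ closedForm p N ℚ.- (+ 4 / 9) ℚ.* (+ (p ^ 6 * N ^ 4) / 1) ∣
               ℚ.≤ + (32 * (p ^ 5 * N ^ 4 + p ^ 6 * N ^ 3)) / 1
  estimate zero    N       prime[0] _ _ = ⊥-elim (¬prime[0] prime[0])
  estimate (suc p) (suc N) _        _ _ = closedForm-estimate p N
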